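{- Let $\mathcal F$ be an algebraic language with no nullary symbols, $\mathbf I=([m];\mathcal F)$ a finite $\mathcal F$-algebra, $\mathbf A$ an $\mathcal F$-algebra with a surjective homomorphism $\chi\colon\mathbf A\to\mathbf I$, $\mathbf C:=\mathfrak C(\mathbf A,\chi)$ and $\alpha:=\ker\chi$. Then for every integer $k\ge2$ and all congruences $\beta_1,\dots,\beta_k$ of $\mathbf A$ with $\beta_j\le\alpha$, \[ [\beta_1,\dots,\beta_k]^*=[\beta_1^*,\dots,\beta_k^*]. \]
   Context: Notation: $[m]=\{1,\dots,m\}$, $m\ge1$; $D^{(i)}:=\chi^{ -1}(i)$. The algebra $\mathfrak C(\mathbf A,\chi)$ has universe $C=D^{(1)}\times\dots\times D^{(m)}$ (elements are columns $\mathbf c=(c^{(1)},\dots,c^{(m)})$) and language consisting of an $m$-ary symbol $d$ and, for each $k$-ary $f\in\mathcal F$ and $\mathbf i=(i_1,\dots,i_k)\in[m]^k$, a $k$-ary symbol $\hat f_{\mathbf i}$, interpreted by $d(\mathbf c_1,\dots,\mathbf c_m)=(c_1^{(1)},c_2^{(2)},\dots,c_m^{(m)})$ and: $\hat f_{\mathbf i}(\mathbf c_1,\dots,\mathbf c_k)$ is obtained from $\mathbf c_1$ by replacing its $f^{\mathbf I}(i_1,\dots,i_k)$-th entry by $f^{\mathbf A}(c_1^{(i_1)},\dots,c_k^{(i_k)})$. For a congruence $\beta\le\alpha$ of $\mathbf A$, $\beta^*:=\{(\mathbf a,\mathbf b)\in C^2:(a^{(i)},b^{(i)})\in\beta\ \forall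 i\in[m]\}$, a congruence of $\mathbf C$. Higher commutator: for congruences $\beta_1,\dots,\beta_k$ of an algebra $\mathbf B$, let $M(\beta_1,\dots,\beta_k)\le\mathbf B^{\{0,1\}^k}$ be generated by all maps $g$ such that for some $j\in[k]$ and $a_0\,\beta_j\,a_1$, $g(\epsilon)=a_{\epsilon_j}$ for all $\epsilon\in\{0,1\}^k$. Then $[\beta_1,\dots,\beta_k]$ is the least congruence $\gamma$ such that for all $f\in M(\beta_1,\dots,\beta_k)$, if $f(\epsilon0)\,\gamma\,f(\epsilon1)$ for all $\epsilon\in\{0,1\}^{k-1}\setminus\{1\dots1\}$ then $f(1\dots10)\,\gamma\,f(1\dots11)$. -}

module Defs where

open import Level using (Level; _⊔_) renaming (suc to lsuc)
open import Data.Nat using (ℕ; zero; suc; _<_; _≤_)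
open import Data.Fin using (Fin; fromℕ<; _≟_)
open import Data.Bool using (Bool; true; false; if_then_else_)
open import Data.Vec using (Vec; lookup; tabulate; map; replicate; _∷ʳ_)
open import Data.Vec.Properties using (tabulate-∘; tabulate-cong; tabulate∘lookup)
open import Data.Product using (Σ; ∃; _×_; _,_; proj₁; proj₂)
open import Data.Sum using (_⊎_; inj₁; inj₂)
open import Data.Unit using (⊤; tt)
open import Relation.Nullary using (¬_; yes; no)
open import Relation.Binary using (Rel; IsEquivalence)
open import Relation.Binary.PropositionalEquality
  using (_≡_; refl; sym; trans; cong)

record Signature : Set₁ where
  field
    Op : Set
    ar : Op → ℕ
open Signature public

NoNullary : Signature → Set
NoNullary σ = (f : Op σ) → 0 < ar σ f

record Alg (σ : Signature) (ℓ : Level) : Set (lsuc ℓ) where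
  field
    Carrier : Set ℓ
    ⟦_⟧     : (f : Op σ) → Vec Carrier (ar σ f) → Carrier


-- A σ-algebra whose carrier is a setoid (equality _≈_); used for 𝐂, whose
-- elements (columns) are functions and hence compared pointwise.
record SAlg (σ : Signature) (ℓ : Level) : Set (lsuc ℓ) where
  field
    Carrier : Set ℓ
    _≈_     : Rel Carrier ℓ
    ⟦_⟧     : (f : Op σ) → Vec Carrier (ar σ f) → Carrier


toS : ∀ {σ ℓ} → Alg σ ℓ → SAlg σ ℓ
toS A = record { Carrier = Alg.Carrier A ; _≈_ = _≡_ ; ⟦_⟧ = Alg.⟦_⟧ A }

FinAlg : Signature → ℕ → Set
FinAlg σ m = (f : Op σ) → Vec (Fin m) (ar σ f) → Fin m

IsHom : ∀ {σ ℓ m} (A : Alg σ ℓ) (I : FinAlg σ m) → (Alg.Carrier A → Fin m) → Set ℓ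
IsHom {σ} A I χ = (f : Op σ) (as : Vec (Alg.Carrier A) (ar σ f)) →
  χ (Alg.⟦_⟧ A f as) ≡ I f (map χ as)

Surjective : ∀ {ℓ m} {X : Set ℓ} → (X → Fin m) → Set ℓ
Surjective {X = X} χ = ∀ i → ∃ λ (a : X) → χ a ≡ i

module _ {σ : Signature} {ℓ : Level} (B : SAlg σ ℓ) where
  open SAlg B renaming (Carrier to X)

  IsCongruence : Rel X ℓ → Set ℓ
  IsCongruence γ =
    IsEquivalence γ ×
    (∀ {x y} → x ≈ y → γ x y) ×
    ((f : Op σ) (xs ys : Vec X (ar σ f)) →
       (∀ r → γ (lookup xs r) (lookup ys r)) → γ (⟦ f ⟧ xs) (⟦ f ⟧ ys))

-- Higher commutator [β₁,…,β_k], k = suc n, cube {0,1}^k = Vec Bool k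
-- (true = 1, false = 0; coordinate j of ε is lookup ε j).

module _ {σ : Signature} {ℓ : Level} (B : SAlg σ ℓ) {n : ℕ} where
  open SAlg B renaming (Carrier to X)

  Cube : Set ℓ
  Cube = Vec Bool (suc n) → X

  data M (βs : Fin (suc n) → Rel X ℓ) : Cube → Set ℓ where
    gen : (j : Fin (suc n)) (a₀ a₁ : X) → βs j a₀ a₁ →
          M βs (λ ε → if lookup ε j then a₁ else a₀)
    op  : (f : Op σ) (gs : Vec Cube (ar σ f)) → (∀ r → M βs (lookup gs r)) →
          M βs (λ ε → ⟦ f ⟧ (map (λ h → h ε) gs))

  TC : (Fin (suc n) → Rel X ℓ) → Rel X ℓ → Set ℓ
  TC βs γ = (g : Cube) → M βs g →
    ((ε : Vec Bool n) → ¬ (ε ≡ replicate n true) →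
       γ (g (ε ∷ʳ false)) (g (ε ∷ʳ true))) →
    γ (g (replicate n true ∷ʳ false)) (g (replicate n true ∷ʳ true))

  IsCommutator : (Fin (suc n) → Rel X ℓ) → Rel X ℓ → Set (lsuc ℓ)
  IsCommutator βs γ =
    IsCongruence B γ × TC βs γ ×
    ((δ : Rel X ℓ) → IsCongruence B δ → TC βs δ → ∀ x y → γ x y → δ x y)

-- language of 𝐂: symbol d (inj₁ tt) and symbols f̂_𝐢 (inj₂ (f , 𝐢))
Ĉσ : Signature → ℕ → Signature
Ĉσ σ m = record
  { Op = ⊤ ⊎ Σ (Op σ) (λ f → Vec (Fin m) (ar σ f))
  ; ar = λ { (inj₁ _) → m ; (inj₂ (f , _)) → ar σ f } }

module _ {σ : Signature} {ℓ : Level} {m : ℕ} (A : Alg σ ℓ) (I : FinAlg σ m)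
         (χ : Alg.Carrier A → Fin m) where
  open Alg A renaming (Carrier to X)

  Col : Set ℓ
  Col = Σ (Fin m → X) (λ c → ∀ i → χ (c i) ≡ i)

  star : Rel X ℓ → Rel Col ℓ
  star β 𝐚 𝐛 = ∀ i → β (proj₁ 𝐚 i) (proj₁ 𝐛 i)

  ker : Rel X _
  ker x y = χ x ≡ χ y

  private
    d : Vec Col m → Col
    d cs = (λ i → proj₁ (lookup cs i) i) , (λ i → proj₂ (lookup cs i) i)

    hat : IsHom A I χ → NoNullary σ → (f : Op σ) (is : Vec (Fin m) (ar σ f)) →
          Vec Col (ar σ f) → Col
    hat hom nn f is cs = c , pc
      where
      args : Vec X (ar σ f)
      args = tabulate (λ r → proj₁ (lookup cs r) (lookup is r))
      p : Fin m
      p = I f is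
      v : X
      v = ⟦ f ⟧ args
      c₁ : Col
      c₁ = lookup cs (fromℕ< (nn f))
      c : Fin m → X
      c i with i ≟ p
      ... | yes _ = v
      ... | no  _ = proj₁ c₁ i
      χv : χ v ≡ p
      χv = trans (hom f args)
             (cong (I f)
               (trans (sym (tabulate-∘ χ (λ r → proj₁ (lookup cs r) (lookup is r))))
                 (trans (tabulate-cong (λ r → proj₂ (lookup cs r) (lookup is r)))
                        (tabulate∘lookup is))))
      pc : ∀ i → χ (c i) ≡ i
      pc i with i ≟ p
      ... | yes i≡p = trans χv (sym i≡p)
      ... | no  _   = proj₂ c₁ i

  ℭ : IsHom A I χ → NoNullary σ → SAlg (Ĉσ σ m) ℓ
  ℭ hom nn = record
    { Carrier = Col
    ; _≈_ = λ 𝐚 𝐛 → ∀ i → proj₁ 𝐚 i ≡ proj₁ 𝐛 i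
    ; ⟦_⟧ = λ { (inj₁ _) → d ; (inj₂ (f , is)) → hat hom nn f is } }

-- Coordinatewise, the generators and operations of 𝐂 are those of 𝐀 (d copies a
-- coordinate, f̂_𝐢 computes f in one coordinate and copies the rest), so every cube of
-- M(β₁*,…,β_k*) is coordinatewise a cube of M(β₁,…,β_k); hence [β₁,…,β_k]* satisfies
-- the term condition for the βⱼ*. Conversely, write c[x] for the column c with x put in
-- coordinate χ(x). For every column c and cube g of M(β₁,…,β_k), c[g] is a cube of
-- M(β₁*,…,β_k*): a new value f(x₁,…,x_r) is computed by f̂_𝐢 in its coordinate
-- χ(f(x₁,…,x_r)) and spliced into c by d. So for a congruence δ of 𝐂 with the term condition,
-- x δ↓ y :⇔ χ x = χ y ∧ ∀ c. c[x] δ c[y] is a congruence of 𝐀 with the term condition;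
-- thus [β₁,…,β_k] ⊆ δ↓, and applying d to the columns a[b⁽ⁱ⁾] gives
-- [β₁,…,β_k]* ⊆ δ.
module Submission where

open import Defs
open import Level using (Level)
open import Data.Nat using (ℕ; suc; _≤_)
open import Data.Fin using (Fin; zero; fromℕ<; _≟_)
open import Data.Bool using (Bool; true; false; if_then_else_)
open import Data.Bool.Properties using (if-float; if-eta)
open import Data.Vec using (Vec; lookup; tabulate; map; replicate; _∷ʳ_)
open import Data.Vec.Properties
  using (lookup-map; lookup∘tabulate; tabulate∘lookup; tabulate-∘; tabulate-cong)
open import Data.Vec.Relation.Binary.Pointwise.Extensional using (ext; Pointwise-≡⇒≡)
open import Data.Product using (_×_; _,_; proj₁; proj₂)
open import Data.Sum using (inj₁; inj₂)
open import Data.Unit using (tt)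
open import Data.Empty using (⊥-elim)
open import Function using (_∘_)
open import Relation.Nullary using (¬_; Dec; yes; no; does)
open import Relation.Binary using (Rel; IsEquivalence)
open import Relation.Binary.PropositionalEquality
  using (_≡_; refl; sym; trans; cong; subst; subst₂; isEquivalence; module ≡-Reasoning)

map≡tabulate : ∀ {a b} {A : Set a} {B : Set b} {k} (f : A → B) (xs : Vec A k) →
  map f xs ≡ tabulate (f ∘ lookup xs)
map≡tabulate f xs = trans (cong (map f) (sym (tabulate∘lookup xs))) (sym (tabulate-∘ f (lookup xs)))

module Congruences {σ : Signature} {ℓ : Level} (B : SAlg σ ℓ) {γ : Rel (SAlg.Carrier B) ℓ}
  (γ-cong : IsCongruence B γ) where
  open SAlg B renaming (Carrier to X)
  private
    module γ = IsEquivalence (proj₁ γ-cong)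
    ≈⊆γ = proj₁ (proj₂ γ-cong)

  congruence-resp-≈ : ∀ {x x′ y y′} → x ≈ x′ → y ≈ y′ → γ x y → γ x′ y′
  congruence-resp-≈ x≈x′ y≈y′ γxy = γ.trans (γ.sym (≈⊆γ x≈x′)) (γ.trans γxy (≈⊆γ y≈y′))

  congruence-resp-≈⁻ : ∀ {x x′ y y′} → x ≈ x′ → y ≈ y′ → γ x′ y′ → γ x y
  congruence-resp-≈⁻ x≈x′ y≈y′ γx′y′ = γ.trans (≈⊆γ x≈x′) (γ.trans γx′y′ (γ.sym (≈⊆γ y≈y′)))

  congruence-tabulate : ∀ f (xs ys : Fin (ar σ f) → X) → (∀ r → γ (xs r) (ys r)) →
    γ (⟦ f ⟧ (tabulate xs)) (⟦ f ⟧ (tabulate ys))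
  congruence-tabulate f xs ys γxsys = proj₂ (proj₂ γ-cong) f _ _ λ r →
    subst₂ γ (sym (lookup∘tabulate xs r)) (sym (lookup∘tabulate ys r)) (γxsys r)

module CubeCalculus {σ : Signature} {ℓ : Level} (B : SAlg σ ℓ) {n : ℕ}
  (βs : Fin (suc n) → Rel (SAlg.Carrier B) ℓ) where
  open SAlg B renaming (Carrier to X)

  TermCondition : Rel X ℓ → Cube B {n} → Set ℓ
  TermCondition γ g =
    ((ε : Vec Bool n) → ¬ (ε ≡ replicate n true) → γ (g (ε ∷ʳ false)) (g (ε ∷ʳ true))) →
    γ (g (replicate n true ∷ʳ false)) (g (replicate n true ∷ʳ true))

  -- M is indexed by functions, so it is not closed under pointwise ≈; cubes are handled up to ≈.
  record M≈ (F : Cube B) : Set ℓ where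
    constructor m≈
    field
      {witness} : Cube B
      witness∈M : M B βs witness
      witness≈ : ∀ ε → witness ε ≈ F ε

  module _ {γ : Rel X ℓ} (γ-cong : IsCongruence B γ) where
    open Congruences B γ-cong

    termCondition-M≈ : TC B βs γ → ∀ {F} → M≈ F → TermCondition γ F
    termCondition-M≈ tc (m≈ G∈M G≈F) hyp =
      congruence-resp-≈ (G≈F _) (G≈F _)
        (tc _ G∈M λ ε ε≢1 → congruence-resp-≈⁻ (G≈F _) (G≈F _) (hyp ε ε≢1))

  module _ (≈-cong : IsCongruence B _≈_) where
    private
      module ≈ = IsEquivalence (proj₁ ≈-cong)

    M≈-resp : ∀ {F F′} → (∀ ε → F ε ≈ F′ ε) → M≈ F → M≈ F′
    M≈-resp F≈F′ (m≈ G∈M G≈F) = m≈ G∈M λ ε → ≈.trans (G≈F ε) (F≈F′ ε)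

    M≈-gen : ∀ j {a₀ a₁} → βs j a₀ a₁ → M≈ (λ ε → if lookup ε j then a₁ else a₀)
    M≈-gen j β = m≈ (gen j _ _ β) λ _ → ≈.refl

    M≈-const : ∀ {a} → βs zero a a → M≈ (λ _ → a)
    M≈-const β = M≈-resp (λ ε → ≈.reflexive (if-eta (lookup ε zero))) (M≈-gen zero β)

    M≈-op : ∀ f (Fs : Fin (ar σ f) → Cube B) → (∀ r → M≈ (Fs r)) →
      M≈ (λ ε → ⟦ f ⟧ (tabulate λ r → Fs r ε))
    M≈-op f Fs Fs∈M =
      m≈ (op f (tabulate Gs) λ r → subst (M B βs) (sym (lookup∘tabulate Gs r)) (M≈.witness∈M (Fs∈M r)))
        λ ε → proj₂ (proj₂ ≈-cong) f _ _ λ r →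
        subst₂ _≈_ (sym (Gs-at r ε)) (sym (lookup∘tabulate _ r)) (M≈.witness≈ (Fs∈M r) ε)
      where
      Gs : Fin (ar σ f) → Cube B
      Gs r = M≈.witness (Fs∈M r)
      Gs-at : ∀ r ε → lookup (map (λ G → G ε) (tabulate Gs)) r ≡ Gs r ε
      Gs-at r ε = trans (lookup-map r _ (tabulate Gs)) (cong (λ G → G ε) (lookup∘tabulate Gs r))

module ColumnAlgebra {ℓ : Level} (σ : Signature) (nn : NoNullary σ) (m : ℕ) (I : FinAlg σ m)
  (A : Alg σ ℓ) (χ : Alg.Carrier A → Fin m) (hom : IsHom A I χ) where
  open Alg A renaming (Carrier to X)

  C : SAlg (Ĉσ σ m) ℓ
  C = ℭ A I χ hom nn

  _≈C_ : Rel (Col A I χ) ℓ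
  _≈C_ = SAlg._≈_ C

  dC : Vec (Col A I χ) m → Col A I χ
  dC = SAlg.⟦_⟧ C (inj₁ tt)

  hatC : (f : Op σ) (is : Vec (Fin m) (ar σ f)) → Vec (Col A I χ) (ar σ f) → Col A I χ
  hatC f is = SAlg.⟦_⟧ C (inj₂ (f , is))

  χ-⟦⟧ : ∀ f (xs : Fin (ar σ f) → X) → χ (⟦ f ⟧ (tabulate xs)) ≡ I f (tabulate (χ ∘ xs))
  χ-⟦⟧ f xs = trans (hom f _) (cong (I f) (sym (tabulate-∘ χ xs)))

  hat-at : ∀ f is cs k → k ≡ I f is →
    proj₁ (hatC f is cs) k ≡ ⟦ f ⟧ (tabulate λ r → proj₁ (lookup cs r) (lookup is r))
  hat-at f is cs k k≡p with k ≟ I f is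
  ... | yes _ = refl
  ... | no k≢p = ⊥-elim (k≢p k≡p)

  hat-off : ∀ f is cs k → ¬ k ≡ I f is →
    proj₁ (hatC f is cs) k ≡ proj₁ (lookup cs (fromℕ< (nn f))) k
  hat-off f is cs k k≢p with k ≟ I f is
  ... | yes k≡p = ⊥-elim (k≢p k≡p)
  ... | no _ = refl

  ≡-isCongruence : IsCongruence (toS A) _≡_
  ≡-isCongruence =
    isEquivalence , (λ x≡y → x≡y) , λ f xs ys xs≡ys → cong ⟦ f ⟧ (Pointwise-≡⇒≡ (ext xs≡ys))

  ≈C-isCongruence : IsCongruence C _≈C_
  ≈C-isCongruence =
    record { refl = λ _ → refl ; sym = λ p i → sym (p i) ; trans = λ p q i → trans (p i) (q i) }
    , (λ p → p) , compatible
    where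
    compatible : ∀ f cs cs′ → (∀ r → lookup cs r ≈C lookup cs′ r) →
      SAlg.⟦_⟧ C f cs ≈C SAlg.⟦_⟧ C f cs′
    compatible (inj₁ tt) cs cs′ cs≈cs′ i = cs≈cs′ i i
    compatible (inj₂ (f , is)) cs cs′ cs≈cs′ i with i ≟ I f is
    ... | yes _ = cong ⟦ f ⟧ (tabulate-cong λ r → cs≈cs′ r (lookup is r))
    ... | no _ = cs≈cs′ (fromℕ< (nn f)) i

  star-isCongruence : ∀ {β} → IsCongruence (toS A) β → IsCongruence C (star A I χ β)
  star-isCongruence {β} β-cong =
    record { refl = λ _ → β.refl ; sym = λ p i → β.sym (p i) ; trans = λ p q i → β.trans (p i) (q i) }
    , (λ p i → proj₁ (proj₂ β-cong) (p i)) , compatible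
    where
    module β = IsEquivalence (proj₁ β-cong)
    open Congruences (toS A) β-cong
    compatible : ∀ f cs cs′ → (∀ r → star A I χ β (lookup cs r) (lookup cs′ r)) →
      star A I χ β (SAlg.⟦_⟧ C f cs) (SAlg.⟦_⟧ C f cs′)
    compatible (inj₁ tt) cs cs′ β* i = β* i i
    compatible (inj₂ (f , is)) cs cs′ β* i with i ≟ I f is
    ... | yes _ = congruence-tabulate f _ _ λ r → β* r (lookup is r)
    ... | no _ = β* (fromℕ< (nn f)) i

  upd₁ : Col A I χ → X → Fin m → X
  upd₁ c x j with j ≟ χ x
  ... | yes _ = x
  ... | no _ = proj₁ c j

  upd : Col A I χ → X → Col A I χ
  upd c x = upd₁ c x , upd₁-fibre
    where
    upd₁-fibre : ∀ j → χ (upd₁ c x j) ≡ j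
    upd₁-fibre j with j ≟ χ x
    ... | yes j≡χx = sym j≡χx
    ... | no _ = proj₂ c j

  upd-at : ∀ c x j → j ≡ χ x → proj₁ (upd c x) j ≡ x
  upd-at c x j j≡χx with j ≟ χ x
  ... | yes _ = refl
  ... | no j≢χx = ⊥-elim (j≢χx j≡χx)

  upd-off : ∀ c x j → ¬ j ≡ χ x → proj₁ (upd c x) j ≡ proj₁ c j
  upd-off c x j j≢χx with j ≟ χ x
  ... | yes j≡χx = ⊥-elim (j≢χx j≡χx)
  ... | no _ = refl

  upd-star : ∀ {β} → (∀ {x} → β x x) → ∀ c {x y} → χ x ≡ χ y → β x y →
    star A I χ β (upd c x) (upd c y)
  upd-star {β} β-refl c {x} {y} χx≡χy βxy j = entry (j ≟ χ x)
    where
    entry : Dec (j ≡ χ x) → β (proj₁ (upd c x) j) (proj₁ (upd c y) j)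
    entry (yes j≡χx) =
      subst₂ β (sym (upd-at c x j j≡χx)) (sym (upd-at c y j (trans j≡χx χx≡χy))) βxy
    entry (no j≢χx) =
      subst₂ β (sym (upd-off c x j j≢χx)) (sym (upd-off c y j λ j≡χy → j≢χx (trans j≡χy (sym χx≡χy))))
        β-refl

  d-upd-diagonal : ∀ c a → dC (tabulate λ k → upd c (proj₁ a k)) ≈C a
  d-upd-diagonal c a k =
    trans (cong (λ Y → proj₁ Y k) (lookup∘tabulate (upd c ∘ proj₁ a) k))
      (upd-at c (proj₁ a k) k (sym (proj₂ a k)))

  splice : Fin m → Col A I χ → Col A I χ → Col A I χ
  splice p Y c = dC (tabulate λ k → if does (k ≟ p) then Y else c)

  splice-upd : ∀ {p Y c v} → p ≡ χ v → proj₁ Y p ≡ v → splice p Y c ≈C upd c v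
  splice-upd {p} {Y} {c} {v} p≡χv Yp≡v k =
    trans (cong (λ Z → proj₁ Z k) (lookup∘tabulate (λ k → if does (k ≟ p) then Y else c) k)) entry
    where
    entry : proj₁ (if does (k ≟ p) then Y else c) k ≡ proj₁ (upd c v) k
    entry with k ≟ p
    ... | yes refl = trans Yp≡v (sym (upd-at c v k p≡χv))
    ... | no k≢p = sym (upd-off c v k λ k≡χv → k≢p (trans k≡χv (sym p≡χv)))

  splice-resp : ∀ {δ} → IsCongruence C δ → ∀ p c {Y Y′} → δ Y Y′ → δ (splice p Y c) (splice p Y′ c)
  splice-resp {δ} δ-cong p c {Y} {Y′} δYY′ = congruence-tabulate (inj₁ tt) _ _ entry
    where
    open Congruences C δ-cong
    entry : ∀ k → δ (if does (k ≟ p) then Y else c) (if does (k ≟ p) then Y′ else c)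
    entry k with k ≟ p
    ... | yes _ = δYY′
    ... | no _ = IsEquivalence.refl (proj₁ δ-cong)

  splice-hat-upd : ∀ f is c (xs : Fin (ar σ f) → X) → (∀ r → lookup is r ≡ χ (xs r)) →
    splice (I f is) (hatC f is (tabulate (upd c ∘ xs))) c ≈C upd c (⟦ f ⟧ (tabulate xs))
  splice-hat-upd f is c xs is≡χxs = splice-upd p≡χv value
    where
    open ≡-Reasoning
    p≡χv : I f is ≡ χ (⟦ f ⟧ (tabulate xs))
    p≡χv = sym (trans (χ-⟦⟧ f xs)
                      (cong (I f) (trans (tabulate-cong (sym ∘ is≡χxs)) (tabulate∘lookup is))))
    value : proj₁ (hatC f is (tabulate (upd c ∘ xs))) (I f is) ≡ ⟦ f ⟧ (tabulate xs)
    value = begin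
      proj₁ (hatC f is (tabulate (upd c ∘ xs))) (I f is)
        ≡⟨ hat-at f is _ _ refl ⟩
      ⟦ f ⟧ (tabulate λ r → proj₁ (lookup (tabulate (upd c ∘ xs)) r) (lookup is r))
        ≡⟨ cong ⟦ f ⟧ (tabulate-cong λ r →
             trans (cong (λ Y → proj₁ Y (lookup is r)) (lookup∘tabulate (upd c ∘ xs) r))
                   (upd-at c (xs r) _ (is≡χxs r))) ⟩
      ⟦ f ⟧ (tabulate xs) ∎

module Cubes {ℓ : Level} (σ : Signature) (nn : NoNullary σ) (m : ℕ) (I : FinAlg σ m)
  (A : Alg σ ℓ) (χ : Alg.Carrier A → Fin m) (hom : IsHom A I χ)
  {n : ℕ} (βs : Fin (suc n) → Rel (Alg.Carrier A) ℓ) where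
  open Alg A renaming (Carrier to X)
  open ColumnAlgebra σ nn m I A χ hom

  βs* : Fin (suc n) → Rel (Col A I χ) ℓ
  βs* j = star A I χ (βs j)

  module 𝐀 = CubeCalculus (toS A) βs
  module 𝐂 = CubeCalculus C βs*

  M-column : ∀ {G} → M C βs* G → ∀ i → 𝐀.M≈ (λ ε → proj₁ (G ε) i)
  M-column (gen j a₀ a₁ β*) i =
    𝐀.M≈-resp ≡-isCongruence (λ ε → sym (if-float (λ (a : Col A I χ) → proj₁ a i) (lookup ε j) {a₁} {a₀}))
      (𝐀.M≈-gen ≡-isCongruence j (β* i))
  M-column (op (inj₁ tt) Gs Gs∈M) i =
    𝐀.M≈-resp ≡-isCongruence (λ ε → cong (λ Y → proj₁ Y i) (sym (lookup-map i (λ H → H ε) Gs)))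
      (M-column (Gs∈M i) i)
  M-column (op (inj₂ (f , is)) Gs Gs∈M) i = hat-column (i ≟ I f is)
    where
    hat-column : Dec (i ≡ I f is) → 𝐀.M≈ (λ ε → proj₁ (hatC f is (map (λ H → H ε) Gs)) i)
    hat-column (yes i≡p) =
      𝐀.M≈-resp ≡-isCongruence
        (λ ε → sym (trans (hat-at f is _ i i≡p) (cong ⟦ f ⟧ (tabulate-cong λ r →
          cong (λ Y → proj₁ Y (lookup is r)) (lookup-map r (λ H → H ε) Gs)))))
        (𝐀.M≈-op ≡-isCongruence f _ λ r → M-column (Gs∈M r) (lookup is r))
    hat-column (no i≢p) =
      𝐀.M≈-resp ≡-isCongruence
        (λ ε → sym (trans (hat-off f is _ i i≢p)
          (cong (λ Y → proj₁ Y i) (lookup-map (fromℕ< (nn f)) (λ H → H ε) Gs))))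
        (M-column (Gs∈M (fromℕ< (nn f))) i)

  M-χ-constant : (∀ j x y → βs j x y → ker A I χ x y) →
    ∀ {g} → M (toS A) βs g → ∀ ε ε′ → χ (g ε) ≡ χ (g ε′)
  M-χ-constant βs⊆ker (gen j a₀ a₁ β) ε ε′ with lookup ε j | lookup ε′ j
  ... | true | true = refl
  ... | false | false = refl
  ... | true | false = sym (βs⊆ker j a₀ a₁ β)
  ... | false | true = βs⊆ker j a₀ a₁ β
  M-χ-constant βs⊆ker (op f gs gs∈M) ε ε′ = begin
    χ (⟦ f ⟧ (map (λ h → h ε) gs))
      ≡⟨ cong (χ ∘ ⟦ f ⟧) (map≡tabulate (λ h → h ε) gs) ⟩
    χ (⟦ f ⟧ (tabulate λ r → lookup gs r ε))
      ≡⟨ χ-⟦⟧ f _ ⟩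
    I f (tabulate λ r → χ (lookup gs r ε))
      ≡⟨ cong (I f) (tabulate-cong λ r → M-χ-constant βs⊆ker (gs∈M r) ε ε′) ⟩
    I f (tabulate λ r → χ (lookup gs r ε′))
      ≡⟨ χ-⟦⟧ f _ ⟨
    χ (⟦ f ⟧ (tabulate λ r → lookup gs r ε′))
      ≡⟨ cong (χ ∘ ⟦ f ⟧) (map≡tabulate (λ h → h ε′) gs) ⟨
    χ (⟦ f ⟧ (map (λ h → h ε′) gs)) ∎
    where open ≡-Reasoning

  module _ (βs-refl : ∀ j {x} → βs j x x) (βs⊆ker : ∀ j x y → βs j x y → ker A I χ x y) where

    M-upd : ∀ {g} → M (toS A) βs g → ∀ c → 𝐂.M≈ (λ ε → upd c (g ε))
    M-upd (gen j a₀ a₁ β) c =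
      𝐂.M≈-resp ≈C-isCongruence (λ ε k → cong (λ a → proj₁ a k) (sym (if-float (upd c) (lookup ε j))))
        (𝐂.M≈-gen ≈C-isCongruence j (upd-star {βs j} (βs-refl j) c (βs⊆ker j a₀ a₁ β) β))
    M-upd (op f gs gs∈M) c =
      𝐂.M≈-resp ≈C-isCongruence spliced≈upd (𝐂.M≈-op ≈C-isCongruence (inj₁ tt) Fs Fs∈M)
      where
      ε₀ : Vec Bool (suc n)
      ε₀ = replicate (suc n) false
      is : Vec (Fin m) (ar σ f)
      is = tabulate λ r → χ (lookup gs r ε₀)
      H : Cube C {n}
      H ε = hatC f is (tabulate λ r → upd c (lookup gs r ε))
      H∈M : 𝐂.M≈ H
      H∈M = 𝐂.M≈-op ≈C-isCongruence (inj₂ (f , is)) (λ r ε → upd c (lookup gs r ε))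
              λ r → M-upd (gs∈M r) c
      Fs : Fin m → Cube C {n}
      Fs k ε = if does (k ≟ I f is) then H ε else c
      pick∈M : ∀ {k} (k≟p : Dec (k ≡ I f is)) → 𝐂.M≈ (λ ε → if does k≟p then H ε else c)
      pick∈M (yes _) = H∈M
      pick∈M (no _) = 𝐂.M≈-const ≈C-isCongruence λ _ → βs-refl zero
      Fs∈M : ∀ k → 𝐂.M≈ (Fs k)
      Fs∈M k = pick∈M (k ≟ I f is)
      spliced≈upd : ∀ ε → splice (I f is) (H ε) c ≈C upd c (⟦ f ⟧ (map (λ h → h ε) gs))
      spliced≈upd ε =
        subst (λ v → splice (I f is) (H ε) c ≈C upd c v)
          (sym (cong ⟦ f ⟧ (map≡tabulate (λ h → h ε) gs)))
          (splice-hat-upd f is c (λ r → lookup gs r ε) λ r →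
            trans (lookup∘tabulate _ r) (M-χ-constant βs⊆ker (gs∈M r) ε₀ ε))

  _↓ : Rel (Col A I χ) ℓ → Rel X ℓ
  (δ ↓) x y = ker A I χ x y × ∀ c → δ (upd c x) (upd c y)

  star-TC : ∀ {γ} → IsCongruence (toS A) γ → TC (toS A) βs γ → TC C βs* (star A I χ γ)
  star-TC γ-cong γ-TC G G∈M hyp i =
    𝐀.termCondition-M≈ γ-cong γ-TC (M-column G∈M i) λ ε ε≢1 → hyp ε ε≢1 i

  module _ {δ : Rel (Col A I χ) ℓ} (δ-cong : IsCongruence C δ) where
    private
      module δ = IsEquivalence (proj₁ δ-cong)
    open Congruences C δ-cong

    ↓-isCongruence : IsCongruence (toS A) (δ ↓)
    ↓-isCongruence =
      record { refl = refl , λ _ → δ.refl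
             ; sym = λ (χx≡χy , x~y) → sym χx≡χy , λ c → δ.sym (x~y c)
             ; trans = λ (χx≡χy , x~y) (χy≡χz , y~z) → trans χx≡χy χy≡χz , λ c → δ.trans (x~y c) (y~z c) }
      , (λ { refl → refl , λ _ → δ.refl }) , compatible
      where
      compatible : ∀ f xs ys → (∀ r → (δ ↓) (lookup xs r) (lookup ys r)) → (δ ↓) (⟦ f ⟧ xs) (⟦ f ⟧ ys)
      compatible f xs ys xs~ys = χ-equal , upd-related
        where
        is : Vec (Fin m) (ar σ f)
        is = map χ xs
        χ-equal : χ (⟦ f ⟧ xs) ≡ χ (⟦ f ⟧ ys)
        χ-equal = trans (hom f xs) (trans (cong (I f) (Pointwise-≡⇒≡ (ext λ r →
          trans (lookup-map r χ xs) (trans (proj₁ (xs~ys r)) (sym (lookup-map r χ ys))))))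
          (sym (hom f ys)))
        hat-related : ∀ c →
          δ (hatC f is (tabulate (upd c ∘ lookup xs))) (hatC f is (tabulate (upd c ∘ lookup ys)))
        hat-related c = congruence-tabulate (inj₂ (f , is)) _ _ λ r → proj₂ (xs~ys r) c
        upd-related : ∀ c → δ (upd c (⟦ f ⟧ xs)) (upd c (⟦ f ⟧ ys))
        upd-related c =
          subst₂ (λ us vs → δ (upd c (⟦ f ⟧ us)) (upd c (⟦ f ⟧ vs))) (tabulate∘lookup xs) (tabulate∘lookup ys)
            (congruence-resp-≈
              (splice-hat-upd f is c (lookup xs) λ r → lookup-map r χ xs)
              (splice-hat-upd f is c (lookup ys) λ r → trans (lookup-map r χ xs) (proj₁ (xs~ys r)))
              (splice-resp δ-cong (I f is) c (hat-related c)))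

    star-↓⊆ : ∀ a b → star A I χ (δ ↓) a b → δ a b
    star-↓⊆ a b a~b =
      congruence-resp-≈ (d-upd-diagonal a a) (d-upd-diagonal a b)
        (congruence-tabulate (inj₁ tt) (upd a ∘ proj₁ a) (upd a ∘ proj₁ b) λ k → proj₂ (a~b k) a)

    module _ (βs-cong : ∀ j → IsCongruence (toS A) (βs j))
             (βs⊆ker : ∀ j x y → βs j x y → ker A I χ x y) where

      ↓-TC : TC C βs* δ → TC (toS A) βs (δ ↓)
      ↓-TC δ-TC g g∈M hyp =
        M-χ-constant βs⊆ker g∈M _ _ ,
        λ c → 𝐂.termCondition-M≈ δ-cong δ-TC (M-upd βs-refl βs⊆ker g∈M c)
                λ ε ε≢1 → proj₂ (hyp ε ε≢1) c
        where
        βs-refl : ∀ j {x} → βs j x x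
        βs-refl j = IsEquivalence.refl (proj₁ (βs-cong j))

theorem3p6 : {ℓ : Level} (σ : Signature) (nn : NoNullary σ)
    (m : ℕ) → 1 ≤ m → (I : FinAlg σ m) (A : Alg σ ℓ)
    (χ : Alg.Carrier A → Fin m) (hom : IsHom A I χ) → Surjective χ →
    (n : ℕ) (βs : Fin (suc (suc n)) → Rel (Alg.Carrier A) ℓ) →
    (∀ j → IsCongruence (toS A) (βs j)) →
    (∀ j x y → βs j x y → ker A I χ x y) →
    (γ : Rel (Alg.Carrier A) ℓ) → IsCommutator (toS A) βs γ →
    IsCommutator (ℭ A I χ hom nn) (λ j → star A I χ (βs j)) (star A I χ γ)
theorem3p6 σ nn m _ I A χ hom _ n βs βs-cong βs⊆ker γ (γ-cong , γ-TC , γ-least) =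
  star-isCongruence γ-cong , star-TC γ-cong γ-TC , γ*-least
  where
  open ColumnAlgebra σ nn m I A χ hom
  open Cubes σ nn m I A χ hom βs
  γ*-least : ∀ δ → IsCongruence C δ → TC C βs* δ → ∀ a b → star A I χ γ a b → δ a b
  γ*-least δ δ-cong δ-TC a b a~b =
    star-↓⊆ δ-cong a b λ i →
      γ-least (δ ↓) (↓-isCongruence δ-cong) (↓-TC δ-cong βs-cong βs⊆ker δ-TC) _ _ (a~b i)
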